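{- Let $f,g\geq 1$ and $r\geq 0$ be integers, let $G$ be a graph and let $Z_0$ be a $2$-clique in $G$. Let $\mathfrak{p}=(Z_0,\ldots,Z_r;\Gamma_i:i\in[r])$ be a $(Z_0,f+g,r)$-phantom in $G$. Then one of the following holds: (a) there is an $(f,g)$-crystal in $G[Z_r]$; or (b) there are $g$ pairwise disjoint $r$-cliques $K_1,\ldots,K_g\subseteq Z_r\setminus Z_0$ in $G$ such that every vertex of $Z_0$ is adjacent to every vertex of $K_1\cup\cdots\cup K_g$.
   Context: Graphs are finite and simple; a $c$-clique is a clique of size $c$ (a $0$-clique is the empty set); $[n]=\{1,\ldots,n\}$. For $Z_0\subseteq V(G)$ and integers $d\geq1$, $r\geq0$, a $(Z_0,d,r)$-phantom in $G$ is a tuple $(Z_0,\ldots,Z_r;\Gamma_i:i\in[r])$ with $Z_0\subseteq\cdots\subseteq Z_r\subseteq V(G)$ such that for every $i\in[r]$, $\Gamma_i$ is a map with domain $E(G[Z_{i-1}])$, where for each edge $e$, $\Gamma_i(e)\subseteq Z_i\setminus Z_{i-1}$, $|\Gamma_i(e)|=d$, both ends of $e$ are adjacent to all of $\Gamma_i(e)$, and distinct edges have disjoint images. For adjacent $z_1,z_2$ in a graph $G'$, a $(z_1,z_2,f,g)$-crystal in $G'$ is a tuple $(S_{1,z},z,S_{2,z}:z\in S)$ with $S$ an $f$-subset of $V(G')\setminus\{z_1,z_2\}$, the sets $S_{1,z},S_{2,z}$ ($z\in S$) pairwise disjoint $g$-subsets of $V(G')\setminus(S\cup\{z_1,z_2\})$,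 and for each $i\in\{1,2\}$, $z\in S$, $x\in S_{i,z}$, the neighbors of $x$ in $\{z_1,z_2,z\}$ are exactly $\{z_i,z\}$. An $(f,g)$-crystal in $G'$ is a $(z_1,z_2,f,g)$-crystal in $G'$ for some adjacent pair $z_1,z_2$ of $G'$. -}

module Defs where

open import Data.Nat using (ℕ; zero; suc)
open import Data.Bool using (Bool; T)
open import Data.Fin using (Fin; zero; suc; inject₁; fromℕ; _<_)
open import Data.Fin.Subset using (Subset; _∈_; _∉_; _⊆_; ∣_∣)
open import Data.Product using (Σ; _×_; _,_; ∃-syntax)
open import Data.Sum using (_⊎_)
open import Data.Empty using (⊥)
open import Relation.Nullary using (¬_)
open import Relation.Binary.PropositionalEquality using (_≡_; _≢_)

record Graph (n : ℕ) : Set where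
  field
    adj     : Fin n → Fin n → Bool
    symm    : ∀ u v → adj u v ≡ adj v u
    irrefl  : ∀ u → adj u u ≡ Data.Bool.false

Adj : ∀ {n} → Graph n → Fin n → Fin n → Set
Adj G u v = T (Graph.adj G u v)

Disjoint : ∀ {n} → Subset n → Subset n → Set
Disjoint A B = ∀ x → x ∈ A → x ∈ B → ⊥

IsClique : ∀ {n} → Graph n → ℕ → Subset n → Set
IsClique G c X = ∣ X ∣ ≡ c × (∀ u v → u ∈ X → v ∈ X → u ≢ v → Adj G u v)

Complete : ∀ {n} → Graph n → Subset n → Subset n → Set
Complete G A B = ∀ u v → u ∈ A → v ∈ B → Adj G u v

-- For i : Fin r, Γ i plays the role of Γ_{i+1}; it maps
-- an edge {u,v} of G[Z_i] (represented uniquely by u < v) to a subset.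
-- Only values on edges are constrained (the map's domain is E(G[Z_i])).
record Phantom {n : ℕ} (G : Graph n) (Z₀ : Subset n) (d r : ℕ) : Set where
  field
    Z      : Fin (suc r) → Subset n
    Γ      : Fin r → Fin n → Fin n → Subset n
    Z-zero : Z zero ≡ Z₀
    Z-mono : ∀ i → Z (inject₁ i) ⊆ Z (suc i)
    Γ-sub  : ∀ i u v → u < v → u ∈ Z (inject₁ i) → v ∈ Z (inject₁ i) → Adj G u v →
             Γ i u v ⊆ Z (suc i) × Disjoint (Γ i u v) (Z (inject₁ i))
    Γ-size : ∀ i u v → u < v → u ∈ Z (inject₁ i) → v ∈ Z (inject₁ i) → Adj G u v →
             ∣ Γ i u v ∣ ≡ d
    Γ-adj  : ∀ i u v → u < v → u ∈ Z (inject₁ i) → v ∈ Z (inject₁ i) → Adj G u v →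
             ∀ x → x ∈ Γ i u v → Adj G u x × Adj G v x
    Γ-disj : ∀ i u v u' v' → u < v → u ∈ Z (inject₁ i) → v ∈ Z (inject₁ i) → Adj G u v →
             u' < v' → u' ∈ Z (inject₁ i) → v' ∈ Z (inject₁ i) → Adj G u' v' →
             ¬ (u ≡ u' × v ≡ v') → Disjoint (Γ i u v) (Γ i u' v')

-- A (z₁,z₂,f,g)-crystal in the induced subgraph G[W].
-- S₁ z, S₂ z are the sets S_{1,z}, S_{2,z} (only meaningful for z ∈ S).
record Crystal {n : ℕ} (G : Graph n) (W : Subset n) (z₁ z₂ : Fin n) (f g : ℕ) : Set where
  field
    S       : Subset n
    S₁ S₂   : Fin n → Subset n
    S-sub   : S ⊆ W
    S-size  : ∣ S ∣ ≡ f
    z₁∉S    : z₁ ∉ S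
    z₂∉S    : z₂ ∉ S
    S₁-sub  : ∀ z → z ∈ S → S₁ z ⊆ W × Disjoint (S₁ z) S × z₁ ∉ S₁ z × z₂ ∉ S₁ z
    S₂-sub  : ∀ z → z ∈ S → S₂ z ⊆ W × Disjoint (S₂ z) S × z₁ ∉ S₂ z × z₂ ∉ S₂ z
    S₁-size : ∀ z → z ∈ S → ∣ S₁ z ∣ ≡ g
    S₂-size : ∀ z → z ∈ S → ∣ S₂ z ∣ ≡ g
    disj₁₁  : ∀ z z' → z ∈ S → z' ∈ S → z ≢ z' → Disjoint (S₁ z) (S₁ z')
    disj₂₂  : ∀ z z' → z ∈ S → z' ∈ S → z ≢ z' → Disjoint (S₂ z) (S₂ z')
    disj₁₂  : ∀ z z' → z ∈ S → z' ∈ S → Disjoint (S₁ z) (S₂ z')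
    nbr₁    : ∀ z → z ∈ S → ∀ x → x ∈ S₁ z → Adj G x z₁ × Adj G x z × ¬ Adj G x z₂
    nbr₂    : ∀ z → z ∈ S → ∀ x → x ∈ S₂ z → Adj G x z₂ × Adj G x z × ¬ Adj G x z₁

HasCrystal : ∀ {n} → Graph n → Subset n → ℕ → ℕ → Set
HasCrystal G W f g =
  ∃[ z₁ ] ∃[ z₂ ] (z₁ ∈ W × z₂ ∈ W × Adj G z₁ z₂ × Crystal G W z₁ z₂ f g)

-- Induction on r, for all 2-cliques Z₀ = {a, b} at once. The set A = Γ₁(ab) consists of f + g
-- common neighbours of a and b. For s ∈ {a, b} and x ∈ A, the edge sx ⊆ Z₁ generates under
-- Γ₂, …, Γᵣ a ({s, x}, f + g, r − 1)-phantom whose vertices meet Z₁ only in {s, x}; since the Γᵢ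
-- add only new vertices and have disjoint images, phantoms generated by edges sx and s'x' with
-- x ≠ x' share only vertices of Z₀. Call x ∈ A rich if, for (s, o) = (a, b) and (b, a), at least
-- g vertices of the phantom of sx are adjacent to s and x but not to o. If f vertices of A are
-- rich, choosing g such vertices for each of them gives an (a, b, f, g)-crystal. Otherwise g
-- vertices x ∈ A are poor for some (s, o). By induction the phantom of sx contains an
-- (f, g)-crystal or g disjoint (r − 1)-cliques complete to {s, x}; as fewer than g of its
-- vertices miss o, one of these cliques is complete to o too, and adding x to it gives an
-- r-clique complete to {a, b}.

{-# OPTIONS --safe #-}
module Submission where

open import Defs
open import Data.Bool using (true; false; T)
open import Data.Empty using (⊥-elim)
open import Data.Fin using (Fin; zero; suc; fromℕ; inject₁; inject≤; _<_; _≟_)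
open import Data.Fin.Induction using (<-weakInduction)
open import Data.Fin.Properties using (any?; _<?_; injective⇒≤; inject≤-injective; suc-injective; <⇒≢; ∀-cons)
open import Data.Fin.Subset
open import Data.Fin.Subset.Properties
open import Data.Nat as ℕ using (ℕ; zero; suc; _+_; _≤_; _≥_; z≤n; s≤s)
open import Data.Nat.Properties as ℕP using (+-suc; +-cancelˡ-≤; +-monoˡ-≤; <⇒≤; <⇒≱; ≰⇒>)
open import Data.Product using (Σ; _×_; _,_; proj₁; proj₂; ∃; ∃₂)
import Data.Sum
open import Data.Sum using (_⊎_; inj₁; inj₂)
open import Data.Vec using ([]; _∷_; tabulate; here; there)
open import Data.Vec.Properties using (lookup∘tabulate; []=⇒lookup; lookup⇒[]=)
open import Function using (_∘_; id)
open import Function.Definitions using (Injective)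
open import Relation.Nullary using (¬_; Dec; yes; no; does; proof; ¬?; _×-dec_; _⊎-dec_)
open import Relation.Nullary.Decidable using (dec-true; decidable-stable; T?)
open import Relation.Nullary.Reflects using (Reflects; invert)
open import Relation.Unary using (Decidable)
open import Relation.Binary.PropositionalEquality using (_≡_; _≢_; refl; sym; trans; cong; subst)

private
  variable
    n k : ℕ
    p : Subset n
    x : Fin n

m+n≡o+p∧m<o⇒p≤n : ∀ {m n o p} → m + n ≡ o + p → m ℕ.< o → p ≤ n
m+n≡o+p∧m<o⇒p≤n {m} {n} {o} {p} eq m<o =
  +-cancelˡ-≤ o p n (subst (_≤ o + n) eq (+-monoˡ-≤ n (<⇒≤ m<o)))

module _ {P : Fin n → Set} (P? : Decidable P) where

  ⟪_⟫ : Subset n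
  ⟪_⟫ = tabulate (does ∘ P?)

  ∈⟪⟫⁺ : P x → x ∈ ⟪_⟫
  ∈⟪⟫⁺ {x} px = lookup⇒[]= x _ (trans (lookup∘tabulate (does ∘ P?) x) (dec-true (P? x) px))

  ∈⟪⟫⁻ : x ∈ ⟪_⟫ → P x
  ∈⟪⟫⁻ {x} x∈ = invert (subst (Reflects (P x)) does≡true (proof (P? x)))
    where
    does≡true : does (P? x) ≡ true
    does≡true = trans (sym (lookup∘tabulate (does ∘ P?) x)) ([]=⇒lookup x∈)

∈∪⁅⁆⁻ : ∀ {y} → x ∈ p ∪ ⁅ y ⁆ → x ∈ p ⊎ x ≡ y
∈∪⁅⁆⁻ {p = p} {y = y} x∈ = Data.Sum.map₂ (x∈⁅y⁆⇒x≡y y) (x∈p∪q⁻ p ⁅ y ⁆ x∈)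

∈⁅⁆∪⁅⁆⁻ : ∀ {y z} → x ∈ ⁅ y ⁆ ∪ ⁅ z ⁆ → x ≡ y ⊎ x ≡ z
∈⁅⁆∪⁅⁆⁻ {y = y} x∈ = Data.Sum.map₁ (x∈⁅y⁆⇒x≡y y) (∈∪⁅⁆⁻ x∈)

∈∪⁅⁆ʳ : x ∈ p ∪ ⁅ x ⁆
∈∪⁅⁆ʳ {x = x} = x∈p∪q⁺ (inj₂ (x∈⁅x⁆ x))

∣p∩q∣+∣p∩∁q∣≡∣p∣ : ∀ (p q : Subset n) → ∣ p ∩ q ∣ + ∣ p ∩ ∁ q ∣ ≡ ∣ p ∣
∣p∩q∣+∣p∩∁q∣≡∣p∣ []          []          = refl
∣p∩q∣+∣p∩∁q∣≡∣p∣ (true  ∷ p) (true  ∷ q) = cong suc (∣p∩q∣+∣p∩∁q∣≡∣p∣ p q)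
∣p∩q∣+∣p∩∁q∣≡∣p∣ (true  ∷ p) (false ∷ q) = trans (+-suc _ _) (cong suc (∣p∩q∣+∣p∩∁q∣≡∣p∣ p q))
∣p∩q∣+∣p∩∁q∣≡∣p∣ (false ∷ p) (_     ∷ q) = ∣p∩q∣+∣p∩∁q∣≡∣p∣ p q

∣p∪⁅x⁆∣≡1+∣p∣ : ∀ (p : Subset n) → x ∉ p → ∣ p ∪ ⁅ x ⁆ ∣ ≡ suc ∣ p ∣
∣p∪⁅x⁆∣≡1+∣p∣ {x = zero}  (true  ∷ p) x∉ = ⊥-elim (x∉ here)
∣p∪⁅x⁆∣≡1+∣p∣ {x = zero}  (false ∷ p) x∉ = cong (suc ∘ ∣_∣) (∪-identityʳ p)
∣p∪⁅x⁆∣≡1+∣p∣ {x = suc x} (true  ∷ p) x∉ = cong suc (∣p∪⁅x⁆∣≡1+∣p∣ p (x∉ ∘ there))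
∣p∪⁅x⁆∣≡1+∣p∣ {x = suc x} (false ∷ p) x∉ = ∣p∪⁅x⁆∣≡1+∣p∣ p (x∉ ∘ there)

select : ∀ (p : Subset n) → Fin ∣ p ∣ → Fin n
select (true  ∷ p) zero    = zero
select (true  ∷ p) (suc i) = suc (select p i)
select (false ∷ p) i       = suc (select p i)

select-∈ : ∀ (p : Subset n) i → select p i ∈ p
select-∈ (true  ∷ p) zero    = here
select-∈ (true  ∷ p) (suc i) = there (select-∈ p i)
select-∈ (false ∷ p) i       = there (select-∈ p i)

select-injective : ∀ (p : Subset n) → Injective _≡_ _≡_ (select p)
select-injective (true  ∷ p) {zero}  {zero}  _  = refl
select-injective (true  ∷ p) {suc i} {suc j} eq = cong suc (select-injective p (suc-injective eq))
select-injective (false ∷ p) eq                 = select-injective p (suc-injective eq)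

rank : ∀ (p : Subset n) → x ∈ p → Fin ∣ p ∣
rank (true  ∷ p) here       = zero
rank (true  ∷ p) (there x∈) = suc (rank p x∈)
rank (false ∷ p) (there x∈) = rank p x∈

rank-injective : ∀ (p : Subset n) {x y} (x∈ : x ∈ p) (y∈ : y ∈ p) → rank p x∈ ≡ rank p y∈ → x ≡ y
rank-injective (true  ∷ p) here       here       _  = refl
rank-injective (true  ∷ p) (there x∈) (there y∈) eq = cong suc (rank-injective p x∈ y∈ (suc-injective eq))
rank-injective (false ∷ p) (there x∈) (there y∈) eq = cong suc (rank-injective p x∈ y∈ eq)

injection⇒≤∣p∣ : (e : Fin k → Fin n) → Injective _≡_ _≡_ e → (∀ j → e j ∈ p) → k ≤ ∣ p ∣
injection⇒≤∣p∣ {p = p} e e-inj e∈ =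
  injective⇒≤ (λ {i} {j} eq → e-inj (rank-injective p (e∈ i) (e∈ j) eq))

≤∣p∣⇒injection : k ≤ ∣ p ∣ → Σ (Fin k → Fin n) λ e → Injective _≡_ _≡_ e × (∀ j → e j ∈ p)
≤∣p∣⇒injection {p = p} k≤∣p∣ =
  (λ j → select p (inject≤ j k≤∣p∣)) ,
  (λ eq → inject≤-injective k≤∣p∣ k≤∣p∣ _ _ (select-injective p eq)) ,
  (λ j → select-∈ p _)

take : ℕ → Subset n → Subset n
take zero    _           = ⊥
take (suc k) []          = []
take (suc k) (true  ∷ p) = inside  ∷ take k p
take (suc k) (false ∷ p) = outside ∷ take (suc k) p

take-⊆ : ∀ k (p : Subset n) → take k p ⊆ p
take-⊆ zero    p           = ⊥⊆
take-⊆ (suc k) (true  ∷ p) here       = here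
take-⊆ (suc k) (true  ∷ p) (there x∈) = there (take-⊆ k p x∈)
take-⊆ (suc k) (false ∷ p) (there x∈) = there (take-⊆ (suc k) p x∈)

∣take∣ : ∀ k (p : Subset n) → k ≤ ∣ p ∣ → ∣ take k p ∣ ≡ k
∣take∣ {n} zero p _ = ∣⊥∣≡0 n
∣take∣ (suc k) (true  ∷ p) (s≤s k≤) = cong suc (∣take∣ k p k≤)
∣take∣ (suc k) (false ∷ p) k<        = ∣take∣ (suc k) p k<

pigeonhole-disjoint : (Q : Fin k → Subset n) → (∀ i j → i ≢ j → Disjoint (Q i) (Q j)) →
                      ∣ p ∣ ℕ.< k → ∃ λ j → Disjoint (Q j) p
pigeonhole-disjoint {k = k} {n = n} {p = p} Q Q-disjoint ∣p∣<k
  with any? (λ j → ¬? (any? (λ v → v ∈? Q j ×-dec v ∈? p)))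
... | yes (j , ¬meets) = j , λ v v∈Q v∈p → ¬meets (v , v∈Q , v∈p)
... | no ¬avoids = ⊥-elim (<⇒≱ ∣p∣<k (injection⇒≤∣p∣ witness witness-injective (proj₂ ∘ proj₂ ∘ meets)))
  where
  meets : ∀ j → ∃ λ v → v ∈ Q j × v ∈ p
  meets j = decidable-stable (any? (λ v → v ∈? Q j ×-dec v ∈? p)) (λ ¬meets → ¬avoids (j , ¬meets))
  witness : Fin k → Fin n
  witness = proj₁ ∘ meets
  witness-injective : Injective _≡_ _≡_ witness
  witness-injective {i} {j} eq with i ≟ j
  ... | yes i≡j = i≡j
  ... | no  i≢j = ⊥-elim (Q-disjoint i j i≢j (witness j)
                    (subst (_∈ Q i) eq (proj₁ (proj₂ (meets i)))) (proj₁ (proj₂ (meets j))))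

⊎-choice : ∀ {A : Set} {B : Fin k → Set} → (∀ j → A ⊎ B j) → A ⊎ (∀ j → B j)
⊎-choice {zero}  h = inj₂ λ ()
⊎-choice {suc k} h with h zero | ⊎-choice (h ∘ suc)
... | inj₁ a | _      = inj₁ a
... | inj₂ _ | inj₁ a = inj₁ a
... | inj₂ b | inj₂ f = inj₂ (∀-cons b f)

∣p∣≡0⇒∉ : ∀ (p : Subset n) → ∣ p ∣ ≡ 0 → x ∉ p
∣p∣≡0⇒∉ (false ∷ p) eq (there x∈) = ∣p∣≡0⇒∉ p eq x∈

∣p∣≡1⇒singleton : ∀ (p : Subset n) → ∣ p ∣ ≡ 1 → ∃ λ a → a ∈ p × (∀ {v} → v ∈ p → v ≡ a)
∣p∣≡1⇒singleton (true ∷ p) eq = zero , here , λ where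
  here       → refl
  (there v∈) → ⊥-elim (∣p∣≡0⇒∉ p (ℕP.suc-injective eq) v∈)
∣p∣≡1⇒singleton (false ∷ p) eq with ∣p∣≡1⇒singleton p eq
... | a , a∈ , unique = suc a , there a∈ , λ where (there v∈) → cong suc (unique v∈)

∣p∣≡2⇒pair : ∀ (p : Subset n) → ∣ p ∣ ≡ 2 →
             ∃₂ λ a b → a < b × a ∈ p × b ∈ p × (∀ {v} → v ∈ p → v ≡ a ⊎ v ≡ b)
∣p∣≡2⇒pair (true ∷ p) eq with ∣p∣≡1⇒singleton p (ℕP.suc-injective eq)
... | b , b∈ , unique = zero , suc b , s≤s z≤n , here , there b∈ , λ where
  here       → inj₁ refl
  (there v∈) → inj₂ (cong suc (unique v∈))
∣p∣≡2⇒pair (false ∷ p) eq with ∣p∣≡2⇒pair p eq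
... | a , b , a<b , a∈ , b∈ , cases = suc a , suc b , s≤s a<b , there a∈ , there b∈ ,
  λ where (there v∈) → Data.Sum.map (cong suc) (cong suc) (cases v∈)

Increasing : ∀ {m} → (Fin (suc m) → Subset n) → Set
Increasing Z = ∀ i → Z (inject₁ i) ⊆ Z (suc i)

zero-⊆ : ∀ {m} {Z : Fin (suc m) → Subset n} → Increasing Z → ∀ k → Z zero ⊆ Z k
zero-⊆ {Z = Z} inc = <-weakInduction (λ k → Z zero ⊆ Z k) id (λ i Z₀⊆ → inc i ∘ Z₀⊆)

module _ {n : ℕ} (G : Graph n) where

  Adj-sym : ∀ {u v} → Adj G u v → Adj G v u
  Adj-sym {u} {v} = subst T (Graph.symm G u v)

  Adj-irrefl : ∀ {u} → ¬ Adj G u u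
  Adj-irrefl {u} = subst T (Graph.irrefl G u)

  Adj? : ∀ u v → Dec (Adj G u v)
  Adj? u v = T? (Graph.adj G u v)

  IsClique-⁅⁆ : ∀ u → IsClique G 1 ⁅ u ⁆
  IsClique-⁅⁆ u = ∣⁅x⁆∣≡1 u , λ v w v∈ w∈ v≢w →
    ⊥-elim (v≢w (trans (x∈⁅y⁆⇒x≡y u v∈) (sym (x∈⁅y⁆⇒x≡y u w∈))))

  IsClique-∪⁅⁆ : ∀ {r K x} → IsClique G r K → x ∉ K → (∀ v → v ∈ K → Adj G x v) →
                 IsClique G (suc r) (K ∪ ⁅ x ⁆)
  IsClique-∪⁅⁆ {K = K} {x} (∣K∣≡r , K-adj) x∉K x-adj =
    trans (∣p∪⁅x⁆∣≡1+∣p∣ K x∉K) (cong suc ∣K∣≡r) , adj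
    where
    adj : ∀ u v → u ∈ K ∪ ⁅ x ⁆ → v ∈ K ∪ ⁅ x ⁆ → u ≢ v → Adj G u v
    adj u v u∈ v∈ u≢v with ∈∪⁅⁆⁻ u∈ | ∈∪⁅⁆⁻ v∈
    ... | inj₁ u∈K  | inj₁ v∈K  = K-adj u v u∈K v∈K u≢v
    ... | inj₁ u∈K  | inj₂ refl = Adj-sym (x-adj u u∈K)
    ... | inj₂ refl | inj₁ v∈K  = x-adj v v∈K
    ... | inj₂ refl | inj₂ refl = ⊥-elim (u≢v refl)

  IsClique-edge : ∀ {u v} → u ≢ v → Adj G u v → IsClique G 2 (⁅ u ⁆ ∪ ⁅ v ⁆)
  IsClique-edge {u} u≢v uv = IsClique-∪⁅⁆ (IsClique-⁅⁆ u) (λ v∈ → u≢v (sym (x∈⁅y⁆⇒x≡y u v∈)))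
    (λ w w∈ → subst (Adj G _) (sym (x∈⁅y⁆⇒x≡y u w∈)) (Adj-sym uv))

  HasCrystal-mono : ∀ {W W' f g} → W ⊆ W' → HasCrystal G W f g → HasCrystal G W' f g
  HasCrystal-mono {W} {W'} W⊆W' (z₁ , z₂ , z₁∈ , z₂∈ , z₁z₂ , c) =
    z₁ , z₂ , W⊆W' z₁∈ , W⊆W' z₂∈ , z₁z₂ , record
    { S = S ; S₁ = S₁ ; S₂ = S₂ ; S-sub = W⊆W' ∘ S-sub ; S-size = S-size ; z₁∉S = z₁∉S ; z₂∉S = z₂∉S
    ; S₁-sub = λ z z∈ → widen (S₁-sub z z∈)
    ; S₂-sub = λ z z∈ → widen (S₂-sub z z∈)
    ; S₁-size = S₁-size ; S₂-size = S₂-size ; disj₁₁ = disj₁₁ ; disj₂₂ = disj₂₂ ; disj₁₂ = disj₁₂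
    ; nbr₁ = nbr₁ ; nbr₂ = nbr₂
    }
    where
    open Crystal c
    widen : ∀ {X} {A : Set} → X ⊆ W × A → X ⊆ W' × A
    widen (X⊆W , a) = (λ x∈ → W⊆W' (X⊆W x∈)) , a

  Edge : Subset n → Fin n → Fin n → Set
  Edge X u v = u < v × u ∈ X × v ∈ X × Adj G u v

  Edge-mono : ∀ {X Y u v} → X ⊆ Y → Edge X u v → Edge Y u v
  Edge-mono X⊆Y (u<v , u∈ , v∈ , uv) = u<v , X⊆Y u∈ , X⊆Y v∈ , uv

  Spawned : (Fin n → Fin n → Subset n) → Subset n → Fin n → Set
  Spawned Γ₀ X v = ∃₂ λ u w → Edge X u w × v ∈ Γ₀ u w

  spawned? : ∀ Γ₀ X → Decidable (Spawned Γ₀ X)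
  spawned? Γ₀ X v = any? λ u → any? λ w →
    (u <? w ×-dec u ∈? X ×-dec w ∈? X ×-dec Adj? u w) ×-dec v ∈? Γ₀ u w

  grow : (Fin n → Fin n → Subset n) → Subset n → Subset n
  grow Γ₀ X = ⟪ (λ v → v ∈? X ⊎-dec spawned? Γ₀ X v) ⟫

  -- Recursing on the shifted family Γ ∘ suc keeps the definition structural; descendants-suc
  -- is the intended one-step unfolding.
  descendants : ∀ {m} → (Fin m → Fin n → Fin n → Subset n) → Subset n → Fin (suc m) → Subset n
  descendants Γ B zero = B
  descendants {suc _} Γ B (suc i) = descendants (Γ ∘ suc) (grow (Γ zero) B) i

  descendants-suc : ∀ {m} (Γ : Fin m → Fin n → Fin n → Subset n) B i →
                    descendants Γ B (suc i) ≡ grow (Γ i) (descendants Γ B (inject₁ i))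
  descendants-suc Γ B zero = refl
  descendants-suc {suc _} Γ B (suc i) = descendants-suc (Γ ∘ suc) (grow (Γ zero) B) i

  module _ {m} (Γ : Fin m → Fin n → Fin n → Subset n) (B : Subset n) (i : Fin m) {v : Fin n} where

    private
      X : Subset n
      X = descendants Γ B (inject₁ i)

    ∈descendants-suc⁻ : v ∈ descendants Γ B (suc i) → v ∈ X ⊎ Spawned (Γ i) X v
    ∈descendants-suc⁻ v∈ = ∈⟪⟫⁻ (λ v → v ∈? X ⊎-dec spawned? (Γ i) X v)
                              (subst (v ∈_) (descendants-suc Γ B i) v∈)

    ∈descendants-suc⁺ : v ∈ X ⊎ Spawned (Γ i) X v → v ∈ descendants Γ B (suc i)
    ∈descendants-suc⁺ h = subst (v ∈_) (sym (descendants-suc Γ B i))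
                            (∈⟪⟫⁺ (λ v → v ∈? X ⊎-dec spawned? (Γ i) X v) h)

  descendants-increasing : ∀ {m} (Γ : Fin m → Fin n → Fin n → Subset n) B → Increasing (descendants Γ B)
  descendants-increasing Γ B i v∈ = ∈descendants-suc⁺ Γ B i (inj₁ v∈)

  ⊆descendants : ∀ {m} (Γ : Fin m → Fin n → Fin n → Subset n) B k → B ⊆ descendants Γ B k
  ⊆descendants Γ B = zero-⊆ {Z = descendants Γ B} (descendants-increasing Γ B)

module PhantomEdges {n : ℕ} {G : Graph n} {Z₀ : Subset n} {d r : ℕ} (p : Phantom G Z₀ d r) where

  open Phantom p

  module _ (i : Fin r) {u w : Fin n} (e : Edge G (Z (inject₁ i)) u w) where

    private
      u<w : u < w
      u<w = proj₁ e
      u∈ : u ∈ Z (inject₁ i)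
      u∈ = proj₁ (proj₂ e)
      w∈ : w ∈ Z (inject₁ i)
      w∈ = proj₁ (proj₂ (proj₂ e))
      uw : Adj G u w
      uw = proj₂ (proj₂ (proj₂ e))

    Γ-⊆ : Γ i u w ⊆ Z (suc i)
    Γ-⊆ = proj₁ (Γ-sub i u w u<w u∈ w∈ uw)

    Γ-fresh : ∀ {v} → v ∈ Γ i u w → v ∉ Z (inject₁ i)
    Γ-fresh = proj₂ (Γ-sub i u w u<w u∈ w∈ uw) _

    ∣Γ∣ : ∣ Γ i u w ∣ ≡ d
    ∣Γ∣ = Γ-size i u w u<w u∈ w∈ uw

    Γ-nbrs : ∀ {v} → v ∈ Γ i u w → Adj G u v × Adj G w v
    Γ-nbrs = Γ-adj i u w u<w u∈ w∈ uw _

    Γ-disjoint : ∀ {u' w'} → Edge G (Z (inject₁ i)) u' w' → ¬ (u ≡ u' × w ≡ w') →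
                 Disjoint (Γ i u w) (Γ i u' w')
    Γ-disjoint (u'<w' , u'∈ , w'∈ , u'w') = Γ-disj i u w _ _ u<w u∈ w∈ uw u'<w' u'∈ w'∈ u'w'

module Descendants {n : ℕ} {G : Graph n} {Z₀ : Subset n} {d r : ℕ} (p : Phantom G Z₀ d (suc r)) where

  open Phantom p
  open PhantomEdges p

  D : Subset n → Fin (suc r) → Subset n
  D = descendants G (Γ ∘ suc)

  Z₁⊆Z : ∀ i → Z (suc zero) ⊆ Z (suc i)
  Z₁⊆Z = zero-⊆ (Z-mono ∘ suc)

  module _ {B : Subset n} (B⊆Z₁ : B ⊆ Z (suc zero)) where

    D-⊆ : ∀ k → D B k ⊆ Z (suc k)
    D-⊆ = <-weakInduction (λ k → D B k ⊆ Z (suc k)) B⊆Z₁ step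
      where
      step : ∀ i → D B (inject₁ i) ⊆ Z (suc (inject₁ i)) → D B (suc i) ⊆ Z (suc (suc i))
      step i D⊆Z v∈ with ∈descendants-suc⁻ G (Γ ∘ suc) B i v∈
      ... | inj₁ v∈D = Z-mono (suc i) (D⊆Z v∈D)
      ... | inj₂ (_ , _ , e , v∈Γ) = Γ-⊆ (suc i) (Edge-mono G D⊆Z e) v∈Γ

    lift : ∀ {i u w} → Edge G (D B (inject₁ i)) u w → Edge G (Z (suc (inject₁ i))) u w
    lift {i} = Edge-mono G (D-⊆ (inject₁ i))

    spawned-fresh : ∀ i {u w v} → Edge G (D B (inject₁ i)) u w → v ∈ Γ (suc i) u w →
                    v ∉ Z (suc (inject₁ i))
    spawned-fresh i e = Γ-fresh (suc i) (lift e)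

    D∩Z₁⊆B : ∀ k {v} → v ∈ D B k → v ∈ Z (suc zero) → v ∈ B
    D∩Z₁⊆B = <-weakInduction (λ k → ∀ {v} → v ∈ D B k → v ∈ Z (suc zero) → v ∈ B) (λ v∈ _ → v∈) step
      where
      step : ∀ i → (∀ {v} → v ∈ D B (inject₁ i) → v ∈ Z (suc zero) → v ∈ B) →
             ∀ {v} → v ∈ D B (suc i) → v ∈ Z (suc zero) → v ∈ B
      step i ih v∈ v∈Z₁ with ∈descendants-suc⁻ G (Γ ∘ suc) B i v∈
      ... | inj₁ v∈D = ih v∈D v∈Z₁
      ... | inj₂ (_ , _ , e , v∈Γ) = ⊥-elim (spawned-fresh i e v∈Γ (Z₁⊆Z (inject₁ i) v∈Z₁))

    descendant-phantom : Phantom G B d r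
    descendant-phantom = record
      { Z      = D B
      ; Γ      = Γ ∘ suc
      ; Z-zero = refl
      ; Z-mono = descendants-increasing G (Γ ∘ suc) B
      ; Γ-sub  = λ i u v u<v u∈ v∈ uv →
          (λ x∈ → ∈descendants-suc⁺ G (Γ ∘ suc) B i (inj₂ (u , v , (u<v , u∈ , v∈ , uv) , x∈))) ,
          (λ x x∈ x∈D → spawned-fresh i (u<v , u∈ , v∈ , uv) x∈ (D-⊆ (inject₁ i) x∈D))
      ; Γ-size = λ i u v u<v u∈ v∈ → Γ-size (suc i) u v u<v (D⊆ i u∈) (D⊆ i v∈)
      ; Γ-adj  = λ i u v u<v u∈ v∈ → Γ-adj (suc i) u v u<v (D⊆ i u∈) (D⊆ i v∈)
      ; Γ-disj = λ i u v u' v' u<v u∈ v∈ uv u'<v' u'∈ v'∈ →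
          Γ-disj (suc i) u v u' v' u<v (D⊆ i u∈) (D⊆ i v∈) uv u'<v' (D⊆ i u'∈) (D⊆ i v'∈)
      }
      where
      D⊆ : ∀ i → D B (inject₁ i) ⊆ Z (suc (inject₁ i))
      D⊆ i = D-⊆ (inject₁ i)

  -- A vertex spawned on both sides comes from a single edge, as the images of Γ are disjoint;
  -- its ends would be two common vertices of B and B'.
  D-∩ : ∀ {B B'} → B ⊆ Z (suc zero) → B' ⊆ Z (suc zero) →
        (∀ {u w} → u ∈ B → u ∈ B' → w ∈ B → w ∈ B' → u ≡ w) →
        ∀ k {v} → v ∈ D B k → v ∈ D B' k → v ∈ B × v ∈ B'
  D-∩ {B} {B'} B⊆Z₁ B'⊆Z₁ B∩B'-subsingleton =
    <-weakInduction (λ k → ∀ {v} → v ∈ D B k → v ∈ D B' k → v ∈ B × v ∈ B') _,_ step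
    where
    step : ∀ i → (∀ {v} → v ∈ D B (inject₁ i) → v ∈ D B' (inject₁ i) → v ∈ B × v ∈ B') →
           ∀ {v} → v ∈ D B (suc i) → v ∈ D B' (suc i) → v ∈ B × v ∈ B'
    step i ih {v} v∈ v∈' with ∈descendants-suc⁻ G (Γ ∘ suc) B i v∈ | ∈descendants-suc⁻ G (Γ ∘ suc) B' i v∈'
    ... | inj₁ v∈D | inj₁ v∈D' = ih v∈D v∈D'
    ... | inj₁ v∈D | inj₂ (_ , _ , e' , v∈Γ') =
      ⊥-elim (spawned-fresh B'⊆Z₁ i e' v∈Γ' (D-⊆ B⊆Z₁ (inject₁ i) v∈D))
    ... | inj₂ (_ , _ , e , v∈Γ) | inj₁ v∈D' =
      ⊥-elim (spawned-fresh B⊆Z₁ i e v∈Γ (D-⊆ B'⊆Z₁ (inject₁ i) v∈D'))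
    ... | inj₂ (u , w , e , v∈Γ) | inj₂ (u' , w' , e' , v∈Γ') with u ≟ u' ×-dec w ≟ w'
    ...   | no other-edge = ⊥-elim (Γ-disjoint (suc i) (lift B⊆Z₁ e) (lift B'⊆Z₁ e') other-edge v v∈Γ v∈Γ')
    ...   | yes (refl , refl) =
      let (u<w , u∈ , w∈ , _) = e ; (_ , u∈' , w∈' , _) = e'
          (u∈B , u∈B') = ih u∈ u∈' ; (w∈B , w∈B') = ih w∈ w∈'
      in ⊥-elim (<⇒≢ u<w (B∩B'-subsingleton u∈B u∈B' w∈B w∈B'))

CompleteClique : ∀ {n} → Graph n → ℕ → Subset n → Subset n → Subset n → Set
CompleteClique G r Z₀ W K = IsClique G r K × K ⊆ W × Disjoint K Z₀ × Complete G Z₀ K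

DisjointCompleteCliques : ∀ {n} → Graph n → ℕ → ℕ → Subset n → Subset n → Set
DisjointCompleteCliques {n} G g r Z₀ W = Σ (Fin g → Subset n) λ K →
  (∀ j → CompleteClique G r Z₀ W (K j)) × (∀ (j j' : Fin g) → j ≢ j' → Disjoint (K j) (K j'))

Outcome : ∀ {n} → Graph n → ℕ → ℕ → ℕ → Subset n → Subset n → Set
Outcome G f g r Z₀ W = HasCrystal G W f g ⊎ DisjointCompleteCliques G g r Z₀ W

empty-cliques : ∀ {n} {G : Graph n} {g Z₀ W} → DisjointCompleteCliques G g 0 Z₀ W
empty-cliques {n} = (λ _ → ⊥) , (λ _ → (∣⊥∣≡0 n , λ _ _ u∈ → ⊥-elim (∉⊥ u∈)) , ⊥⊆ , (λ _ → ⊥-elim ∘ ∉⊥) ,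
                                      λ _ _ _ → ⊥-elim ∘ ∉⊥) ,
                    λ _ _ _ _ → ⊥-elim ∘ ∉⊥

Claim : ∀ {n} → Graph n → ℕ → ℕ → ℕ → Set
Claim G f g r = ∀ {Z₀} → IsClique G 2 Z₀ → (p : Phantom G Z₀ (f + g) r) →
                Outcome G f g r Z₀ (Phantom.Z p (fromℕ r))

module InductionStep {n : ℕ} {G : Graph n} {f g r : ℕ} (IH : Claim G f g r)
            {Z₀ : Subset n} (p : Phantom G Z₀ (f + g) (suc r))
            {a b : Fin n} (a<b : a < b) (a∈Z₀ : a ∈ Z₀) (b∈Z₀ : b ∈ Z₀)
            (Z₀⊆ab : ∀ {v} → v ∈ Z₀ → v ≡ a ⊎ v ≡ b) (ab : Adj G a b) where

  open Phantom p
  open PhantomEdges p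
  open Descendants p

  W : Subset n
  W = Z (fromℕ (suc r))

  Z₁ : Subset n
  Z₁ = Z (suc zero)

  Z₀⊆Z₁ : Z₀ ⊆ Z₁
  Z₀⊆Z₁ = Z-mono zero ∘ subst (_ ∈_) (sym Z-zero)

  Z₁⊆W : Z₁ ⊆ W
  Z₁⊆W = Z₁⊆Z (fromℕ r)

  ab-edge : Edge G (Z zero) a b
  ab-edge = a<b , subst (a ∈_) (sym Z-zero) a∈Z₀ , subst (b ∈_) (sym Z-zero) b∈Z₀ , ab

  A : Subset n
  A = Γ zero a b

  A⊆Z₁ : A ⊆ Z₁
  A⊆Z₁ = Γ-⊆ zero ab-edge

  A-fresh : ∀ {x} → x ∈ A → x ∉ Z₀
  A-fresh x∈A = Γ-fresh zero ab-edge x∈A ∘ subst (_ ∈_) (sym Z-zero)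

  Z₀-A-adj : ∀ {s x} → s ∈ Z₀ → x ∈ A → Adj G s x
  Z₀-A-adj s∈Z₀ x∈A with Z₀⊆ab s∈Z₀
  ... | inj₁ refl = proj₁ (Γ-nbrs zero ab-edge x∈A)
  ... | inj₂ refl = proj₂ (Γ-nbrs zero ab-edge x∈A)

  pair-⊆Z₁ : ∀ {s x} → s ∈ Z₀ → x ∈ A → ⁅ s ⁆ ∪ ⁅ x ⁆ ⊆ Z₁
  pair-⊆Z₁ s∈Z₀ x∈A v∈ with ∈⁅⁆∪⁅⁆⁻ v∈
  ... | inj₁ refl = Z₀⊆Z₁ s∈Z₀
  ... | inj₂ refl = A⊆Z₁ x∈A

  pair-∩ : ∀ {s s' x x' v} → s' ∈ Z₀ → x ∈ A → x ≢ x' →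
           v ∈ ⁅ s ⁆ ∪ ⁅ x ⁆ → v ∈ ⁅ s' ⁆ ∪ ⁅ x' ⁆ → v ≡ s
  pair-∩ s'∈Z₀ x∈A x≢x' v∈ v∈' with ∈⁅⁆∪⁅⁆⁻ v∈ | ∈⁅⁆∪⁅⁆⁻ v∈'
  ... | inj₁ v≡s  | _         = v≡s
  ... | inj₂ refl | inj₁ refl = ⊥-elim (A-fresh x∈A s'∈Z₀)
  ... | inj₂ refl | inj₂ refl = ⊥-elim (x≢x' refl)

  Desc : Fin n → Fin n → Subset n
  Desc s x = D (⁅ s ⁆ ∪ ⁅ x ⁆) (fromℕ r)

  module _ {s x : Fin n} (s∈Z₀ : s ∈ Z₀) (x∈A : x ∈ A) where

    Desc⊆W : Desc s x ⊆ W
    Desc⊆W = D-⊆ (pair-⊆Z₁ s∈Z₀ x∈A) (fromℕ r)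

    Desc∩Z₁ : ∀ {v} → v ∈ Desc s x → v ∈ Z₁ → v ∈ ⁅ s ⁆ ∪ ⁅ x ⁆
    Desc∩Z₁ = D∩Z₁⊆B (pair-⊆Z₁ s∈Z₀ x∈A) (fromℕ r)

    x∈Desc : x ∈ Desc s x
    x∈Desc = ⊆descendants G (Γ ∘ suc) _ (fromℕ r) (∈∪⁅⁆ʳ {p = ⁅ s ⁆})

    sx-edge : IsClique G 2 (⁅ s ⁆ ∪ ⁅ x ⁆)
    sx-edge = IsClique-edge G (λ { refl → A-fresh x∈A s∈Z₀ }) (Z₀-A-adj s∈Z₀ x∈A)

    sx-outcome : Outcome G f g r (⁅ s ⁆ ∪ ⁅ x ⁆) (Desc s x)
    sx-outcome = IH sx-edge (descendant-phantom (pair-⊆Z₁ s∈Z₀ x∈A))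

  Desc-∩ : ∀ {s s' x x' v} → s ∈ Z₀ → s' ∈ Z₀ → x ∈ A → x' ∈ A → x ≢ x' →
           v ∈ Desc s x → v ∈ Desc s' x' → v ∈ Z₀
  Desc-∩ {s} {s'} {x} {x'} s∈Z₀ s'∈Z₀ x∈A x'∈A x≢x' v∈ v∈' =
    let (v∈sx , v∈s'x') = D-∩ (pair-⊆Z₁ s∈Z₀ x∈A) (pair-⊆Z₁ s'∈Z₀ x'∈A) subsingleton (fromℕ r) v∈ v∈'
    in subst (_∈ Z₀) (sym (≡s v∈sx v∈s'x')) s∈Z₀
    where
    ≡s : ∀ {u} → u ∈ ⁅ s ⁆ ∪ ⁅ x ⁆ → u ∈ ⁅ s' ⁆ ∪ ⁅ x' ⁆ → u ≡ s
    ≡s = pair-∩ s'∈Z₀ x∈A x≢x'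
    subsingleton : ∀ {u w} → u ∈ ⁅ s ⁆ ∪ ⁅ x ⁆ → u ∈ ⁅ s' ⁆ ∪ ⁅ x' ⁆ →
                   w ∈ ⁅ s ⁆ ∪ ⁅ x ⁆ → w ∈ ⁅ s' ⁆ ∪ ⁅ x' ⁆ → u ≡ w
    subsingleton u∈ u∈' w∈ w∈' = trans (≡s u∈ u∈') (sym (≡s w∈ w∈'))

  IsExclusive : Fin n → Fin n → Fin n → Fin n → Set
  IsExclusive s o x v = v ∈ Desc s x × Adj G v s × Adj G v x × ¬ Adj G v o

  exclusive? : ∀ s o x → Decidable (IsExclusive s o x)
  exclusive? s o x v = v ∈? Desc s x ×-dec Adj? G v s ×-dec Adj? G v x ×-dec ¬? (Adj? G v o)

  Exclusive : Fin n → Fin n → Fin n → Subset n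
  Exclusive s o x = ⟪ exclusive? s o x ⟫

  Exclusive⁻ : ∀ {s o x v} → v ∈ Exclusive s o x → IsExclusive s o x v
  Exclusive⁻ {s} {o} {x} = ∈⟪⟫⁻ (exclusive? s o x)

  Exclusive-∉Z₁ : ∀ {s o x v} → s ∈ Z₀ → x ∈ A → v ∈ Exclusive s o x → v ∉ Z₁
  Exclusive-∉Z₁ s∈Z₀ x∈A v∈ v∈Z₁ with Exclusive⁻ v∈
  ... | v∈D , vs , vx , _ with ∈⁅⁆∪⁅⁆⁻ (Desc∩Z₁ s∈Z₀ x∈A v∈D v∈Z₁)
  ...   | inj₁ refl = Adj-irrefl G vs
  ...   | inj₂ refl = Adj-irrefl G vx

  Exclusive-disjoint : ∀ {s s' o o' x x'} → s ∈ Z₀ → s' ∈ Z₀ → x ∈ A → x' ∈ A → x ≢ x' →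
                       Disjoint (Exclusive s o x) (Exclusive s' o' x')
  Exclusive-disjoint s∈Z₀ s'∈Z₀ x∈A x'∈A x≢x' v v∈ v∈' =
    Exclusive-∉Z₁ s∈Z₀ x∈A v∈
      (Z₀⊆Z₁ (Desc-∩ s∈Z₀ s'∈Z₀ x∈A x'∈A x≢x' (proj₁ (Exclusive⁻ v∈)) (proj₁ (Exclusive⁻ v∈'))))

  Rich : Fin n → Set
  Rich x = g ≤ ∣ Exclusive a b x ∣ × g ≤ ∣ Exclusive b a x ∣

  rich? : Decidable Rich
  rich? x = g ℕ.≤? ∣ Exclusive a b x ∣ ×-dec g ℕ.≤? ∣ Exclusive b a x ∣

  crystal : f ≤ ∣ A ∩ ⟪ rich? ⟫ ∣ → HasCrystal G W f g
  crystal f≤ = a , b , Z₁⊆W (Z₀⊆Z₁ a∈Z₀) , Z₁⊆W (Z₀⊆Z₁ b∈Z₀) , ab , record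
    { S       = S
    ; S₁      = S₁
    ; S₂      = S₂
    ; S-sub   = Z₁⊆W ∘ A⊆Z₁ ∘ S⊆A
    ; S-size  = ∣take∣ f _ f≤
    ; z₁∉S    = λ a∈S → A-fresh (S⊆A a∈S) a∈Z₀
    ; z₂∉S    = λ b∈S → A-fresh (S⊆A b∈S) b∈Z₀
    ; S₁-sub  = λ z z∈S → side a∈Z₀ (S⊆A z∈S)
    ; S₂-sub  = λ z z∈S → side b∈Z₀ (S⊆A z∈S)
    ; S₁-size = λ z z∈S → ∣take∣ g _ (proj₁ (S-rich z∈S))
    ; S₂-size = λ z z∈S → ∣take∣ g _ (proj₂ (S-rich z∈S))
    ; disj₁₁  = λ z z' z∈S z'∈S z≢z' v v∈ v∈' →
                  Exclusive-disjoint a∈Z₀ a∈Z₀ (S⊆A z∈S) (S⊆A z'∈S) z≢z' v (take-⊆ g _ v∈) (take-⊆ g _ v∈')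
    ; disj₂₂  = λ z z' z∈S z'∈S z≢z' v v∈ v∈' →
                  Exclusive-disjoint b∈Z₀ b∈Z₀ (S⊆A z∈S) (S⊆A z'∈S) z≢z' v (take-⊆ g _ v∈) (take-⊆ g _ v∈')
    ; disj₁₂  = λ z z' _ _ v v∈ v∈' →
                  let (_ , _ , _ , ¬vb) = chosen⁻ v∈ ; (_ , vb , _) = chosen⁻ v∈' in ¬vb vb
    ; nbr₁    = λ z _ v v∈ → proj₂ (chosen⁻ v∈)
    ; nbr₂    = λ z _ v v∈ → proj₂ (chosen⁻ v∈)
    }
    where
    S : Subset n
    S = take f (A ∩ ⟪ rich? ⟫)
    S₁ S₂ : Fin n → Subset n
    S₁ z = take g (Exclusive a b z)
    S₂ z = take g (Exclusive b a z)
    S⊆A : S ⊆ A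
    S⊆A = p∩q⊆p A _ ∘ take-⊆ f _
    S-rich : ∀ {z} → z ∈ S → Rich z
    S-rich = ∈⟪⟫⁻ rich? ∘ p∩q⊆q A _ ∘ take-⊆ f _
    chosen⁻ : ∀ {s o z v} → v ∈ take g (Exclusive s o z) → IsExclusive s o z v
    chosen⁻ = Exclusive⁻ ∘ take-⊆ g _
    side : ∀ {s o z} → s ∈ Z₀ → z ∈ A → let T = take g (Exclusive s o z) in
           T ⊆ W × Disjoint T S × a ∉ T × b ∉ T
    side {s} {o} {z} s∈Z₀ z∈A =
      Desc⊆W s∈Z₀ z∈A ∘ proj₁ ∘ chosen⁻ ,
      (λ v v∈T v∈S → outside-Z₁ v∈T (A⊆Z₁ (S⊆A v∈S))) ,
      (λ a∈T → outside-Z₁ a∈T (Z₀⊆Z₁ a∈Z₀)) ,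
      (λ b∈T → outside-Z₁ b∈T (Z₀⊆Z₁ b∈Z₀))
      where
      outside-Z₁ : ∀ {v} → v ∈ take g (Exclusive s o z) → v ∉ Z₁
      outside-Z₁ = Exclusive-∉Z₁ s∈Z₀ z∈A ∘ take-⊆ g _

  record Extension (x : Fin n) : Set where
    field
      K       : Subset n
      clique  : CompleteClique G (suc r) Z₀ W K
      base    : Fin n
      base∈Z₀ : base ∈ Z₀
      K⊆Desc  : K ⊆ Desc base x

  module _ {s o x : Fin n} (s∈Z₀ : s ∈ Z₀) (x∈A : x ∈ A) (Z₀⊆so : ∀ {v} → v ∈ Z₀ → v ≡ s ⊎ v ≡ o) where

    extend : ∀ {Q} → CompleteClique G r (⁅ s ⁆ ∪ ⁅ x ⁆) (Desc s x) Q → Disjoint Q (Exclusive s o x) →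
             Extension x
    extend {Q} (Q-clique , Q⊆D , Q-fresh , Q-complete) Q-avoids = record
      { K = Q ∪ ⁅ x ⁆ ; clique = K-clique , Desc⊆W s∈Z₀ x∈A ∘ K⊆D , K-fresh , K-complete
      ; base = s ; base∈Z₀ = s∈Z₀ ; K⊆Desc = K⊆D }
      where
      s∈sx : s ∈ ⁅ s ⁆ ∪ ⁅ x ⁆
      s∈sx = x∈p∪q⁺ (inj₁ (x∈⁅x⁆ s))
      x∈sx : x ∈ ⁅ s ⁆ ∪ ⁅ x ⁆
      x∈sx = ∈∪⁅⁆ʳ {p = ⁅ s ⁆}
      K-clique : IsClique G (suc r) (Q ∪ ⁅ x ⁆)
      K-clique = IsClique-∪⁅⁆ G Q-clique (λ x∈Q → Q-fresh x x∈Q x∈sx) (λ v → Q-complete x v x∈sx)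
      K⊆D : Q ∪ ⁅ x ⁆ ⊆ Desc s x
      K⊆D v∈ with ∈∪⁅⁆⁻ v∈
      ... | inj₁ v∈Q  = Q⊆D v∈Q
      ... | inj₂ refl = x∈Desc s∈Z₀ x∈A
      K-fresh : Disjoint (Q ∪ ⁅ x ⁆) Z₀
      K-fresh v v∈ v∈Z₀ with ∈∪⁅⁆⁻ v∈
      ... | inj₁ v∈Q  = Q-fresh v v∈Q (Desc∩Z₁ s∈Z₀ x∈A (Q⊆D v∈Q) (Z₀⊆Z₁ v∈Z₀))
      ... | inj₂ refl = A-fresh x∈A v∈Z₀
      K-complete : Complete G Z₀ (Q ∪ ⁅ x ⁆)
      K-complete u v u∈Z₀ v∈ with ∈∪⁅⁆⁻ v∈ | Z₀⊆so u∈Z₀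
      ... | inj₂ refl | _         = Z₀-A-adj u∈Z₀ x∈A
      ... | inj₁ v∈Q  | inj₁ refl = Q-complete s v s∈sx v∈Q
      -- v sees s and x, so if it missed o it would lie in Exclusive s o x, which Q avoids.
      ... | inj₁ v∈Q  | inj₂ refl with Adj? G v o
      ...   | yes vo = Adj-sym G vo
      ...   | no ¬vo = ⊥-elim (Q-avoids v v∈Q (∈⟪⟫⁺ (exclusive? s o x)
                         (Q⊆D v∈Q , Adj-sym G (Q-complete s v s∈sx v∈Q) ,
                          Adj-sym G (Q-complete x v x∈sx v∈Q) , ¬vo)))

    extension : ∣ Exclusive s o x ∣ ℕ.< g → HasCrystal G W f g ⊎ Extension x
    extension few with sx-outcome s∈Z₀ x∈A
    ... | inj₁ crystal = inj₁ (HasCrystal-mono G (Desc⊆W s∈Z₀ x∈A) crystal)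
    ... | inj₂ (Q , Q-cliques , Q-disjoint) =
      let (j , Qj-avoids) = pigeonhole-disjoint Q Q-disjoint few in inj₂ (extend (Q-cliques j) Qj-avoids)

  poor-extension : ∀ {x} → x ∈ A → ¬ Rich x → HasCrystal G W f g ⊎ Extension x
  poor-extension {x} x∈A poor with g ℕ.≤? ∣ Exclusive a b x ∣
  ... | no  g≰ = extension a∈Z₀ x∈A Z₀⊆ab (≰⇒> g≰)
  ... | yes g≤ = extension b∈Z₀ x∈A (Data.Sum.swap ∘ Z₀⊆ab) (≰⇒> (λ g≤' → poor (g≤ , g≤')))

  extensions-disjoint : (e : Fin g → Fin n) → Injective _≡_ _≡_ e → (∀ j → e j ∈ A) →
                        (∀ j → Extension (e j)) → DisjointCompleteCliques G g (suc r) Z₀ W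
  extensions-disjoint e e-injective e∈A ext = K ∘ ext , clique ∘ ext , disjoint
    where
    open Extension
    disjoint : ∀ j j' → j ≢ j' → Disjoint (K (ext j)) (K (ext j'))
    disjoint j j' j≢j' v v∈ v∈' =
      let (_ , _ , K-fresh , _) = clique (ext j) in K-fresh v v∈
      (Desc-∩ (base∈Z₀ (ext j)) (base∈Z₀ (ext j')) (e∈A j) (e∈A j') (j≢j' ∘ e-injective)
              (K⊆Desc (ext j) v∈) (K⊆Desc (ext j') v∈'))

  poor-cliques : g ≤ ∣ A ∩ ∁ ⟪ rich? ⟫ ∣ → Outcome G f g (suc r) Z₀ W
  poor-cliques g≤ =
    let (e , e-injective , e-poor) = ≤∣p∣⇒injection g≤ in
    Data.Sum.map₂ (extensions-disjoint e e-injective (∈A ∘ e-poor))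
                  (⊎-choice (λ j → poor-extension (∈A (e-poor j)) (not-rich (e-poor j))))
    where
    ∈A : ∀ {x} → x ∈ A ∩ ∁ ⟪ rich? ⟫ → x ∈ A
    ∈A = p∩q⊆p A _
    not-rich : ∀ {x} → x ∈ A ∩ ∁ ⟪ rich? ⟫ → ¬ Rich x
    not-rich x∈ = x∈∁p⇒x∉p (p∩q⊆q A _ x∈) ∘ ∈⟪⟫⁺ rich?

  outcome : Outcome G f g (suc r) Z₀ W
  outcome with f ℕ.≤? ∣ A ∩ ⟪ rich? ⟫ ∣
  ... | yes f≤ = inj₁ (crystal f≤)
  ... | no  f≰ = poor-cliques (m+n≡o+p∧m<o⇒p≤n ∣rich∣+∣poor∣≡f+g (≰⇒> f≰))
    where
    ∣rich∣+∣poor∣≡f+g : ∣ A ∩ ⟪ rich? ⟫ ∣ + ∣ A ∩ ∁ ⟪ rich? ⟫ ∣ ≡ f + g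
    ∣rich∣+∣poor∣≡f+g = trans (∣p∩q∣+∣p∩∁q∣≡∣p∣ A _) (∣Γ∣ zero ab-edge)

claim : ∀ {n} (G : Graph n) f g r → Claim G f g r
claim G f g zero    _ _ = inj₂ (empty-cliques {G = G} {g = g})
claim G f g (suc r) (∣Z₀∣≡2 , Z₀-adj) p with ∣p∣≡2⇒pair _ ∣Z₀∣≡2
... | a , b , a<b , a∈Z₀ , b∈Z₀ , Z₀⊆ab =
  InductionStep.outcome (claim G f g r) p a<b a∈Z₀ b∈Z₀ Z₀⊆ab (Z₀-adj a b a∈Z₀ b∈Z₀ (<⇒≢ a<b))

theorem4p2 : (f g r : ℕ) → f ≥ 1 → g ≥ 1 → {n : ℕ} → (G : Graph n) → (Z₀ : Subset n) →
    IsClique G 2 Z₀ → (p : Phantom G Z₀ (f + g) r) →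
    HasCrystal G (Phantom.Z p (fromℕ r)) f g
    ⊎ (Σ (Fin g → Subset n) λ K → ((∀ j → IsClique G r (K j) × K j ⊆ Phantom.Z p (fromℕ r) × Disjoint (K j) Z₀
                     × Complete G Z₀ (K j))
               × (∀ (j j' : Fin g) → j ≢ j' → Disjoint (K j) (K j'))))
theorem4p2 f g r _ _ G Z₀ = claim G f g r
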